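{- Let $G$ be a group and $H$ a subgroup. Let $\sim$ be a nontrivial equivalence relation on $G/H-\{\bar 1\}$ such that for $a,b\in G$, if $\bar a\sim\bar b$ and $\bar a\neq\bar b$ then $\overline{a^{ -1}}\sim\overline{a^{ -1}b}$. Let $a,b\in G$. If $\overline{g^{ -1}a}\sim\overline{g^{ -1}b}$ for all $g\notin aH\cup bH$, then $\bar a=\bar b$.
   Context: $G/H$ is the set of left cosets, $\bar a=aH$, $\bar 1=H$. An equivalence relation is nontrivial if it has at least two classes. -}

module Defs where

open import Level using (Level; _⊔_)
open import Algebra.Bundles using (Group)
open import Data.Product using (Σ; _×_; ∃; ∃-syntax)
open import Relation.Nullary using (¬_)

module _ {c ℓ : Level} (G : Group c ℓ) where
  open Group G using (Carrier; _≈_; _∙_; ε; _⁻¹)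

  record IsSubgroup {h : Level} (H : Carrier → Set h) : Set (c ⊔ ℓ ⊔ h) where
    field
      resp   : ∀ {x y} → x ≈ y → H x → H y
      ε∈     : H ε
      ∙-closed : ∀ {x y} → H x → H y → H (x ∙ y)
      ⁻¹-closed : ∀ {x} → H x → H (x ⁻¹)

  CosetEq : {h : Level} (H : Carrier → Set h) → Carrier → Carrier → Set h
  CosetEq H a b = H (a ⁻¹ ∙ b)

  -- An equivalence relation ∼ on G/H − {1̄}, presented through representatives:
  -- R a b means  ā ∼ b̄.
  record IsCosetEquivalence {h r : Level} (H : Carrier → Set h)
         (R : Carrier → Carrier → Set r) : Set (c ⊔ h ⊔ r) where
    field
      domain   : ∀ {a b} → R a b → ¬ CosetEq H a ε × ¬ CosetEq H b ε
      wellDef  : ∀ {a a′ b b′} → CosetEq H a a′ → CosetEq H b b′ → R a b → R a′ b′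
      reflexive : ∀ {a} → ¬ CosetEq H a ε → R a a
      symmetric : ∀ {a b} → R a b → R b a
      transitive : ∀ {a b d} → R a b → R b d → R a d

  Nontrivial : {h r : Level} (H : Carrier → Set h)
               (R : Carrier → Carrier → Set r) → Set (c ⊔ h ⊔ r)
  Nontrivial H R = ∃[ a ] ∃[ b ] (¬ CosetEq H a ε × ¬ CosetEq H b ε × ¬ R a b)

{-# OPTIONS --safe #-}
-- Translate ∼ to every base point: x ∼[ g ] y means g⁻¹x ∼ g⁻¹y, an equivalence on the
-- cosets other than ḡ.  The hypothesis on ∼ says exactly that ∼[ g ] can be rotated:
-- if x ∼[ g ] y and x̄ ≠ ȳ then g ∼[ x ] y.  Suppose ā ≠ b̄, say ā ≠ 1̄.  Rotating the
-- assumption gives z ∼[ a ] b for every z̄ ≠ ā, so 1 ∼[ a ] x for every x̄ ≠ ā, 1̄, and one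
-- more rotation gives a ∼ x.  Hence ∼ has a single class, contradicting nontriviality.
module Submission where

open import Defs
open import Level using (Level)
open import Algebra.Bundles using (Group)
open import Axiom.ExcludedMiddle using (ExcludedMiddle)
open import Data.Empty using (⊥-elim)
open import Data.Product using (_,_)
open import Function using (_∘_)
open import Relation.Binary.Definitions using (Decidable)
open import Relation.Nullary using (¬_; yes; no)
import Algebra.Properties.Group as GroupProperties
import Algebra.Properties.Monoid as MonoidProperties

module _ {c ℓ} (G : Group c ℓ) where
  open Group G
  open GroupProperties G
  open MonoidProperties monoid using (cancelᶜ)

  ε\\x≈x : ∀ x → ε \\ x ≈ x
  ε\\x≈x x = trans (∙-congʳ ε⁻¹≈ε) (identityˡ x)

  translate-\\ : ∀ g x y → (g ∙ x) \\ (g ∙ y) ≈ x \\ y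
  translate-\\ g x y = trans (∙-congʳ (⁻¹-anti-homo-∙ g x)) (cancelᶜ (inverseˡ g) (x ⁻¹) y)

  module _ {h} {H : Carrier → Set h} (sub : IsSubgroup G H) where
    open IsSubgroup sub

    infix 4 _≐_
    _≐_ : Carrier → Carrier → Set h
    _≐_ = CosetEq G H

    ≈⇒≐ : ∀ {x y} → x ≈ y → x ≐ y
    ≈⇒≐ {x} x≈y = resp (trans (sym (inverseˡ x)) (∙-congˡ x≈y)) ε∈

    ≐-refl : ∀ {x} → x ≐ x
    ≐-refl = ≈⇒≐ refl

    ≐-sym : ∀ {x y} → x ≐ y → y ≐ x
    ≐-sym {x} {y} = resp (⁻¹-anti-homo-\\ x y) ∘ ⁻¹-closed

    ≐-trans : ∀ {x y z} → x ≐ y → y ≐ z → x ≐ z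
    ≐-trans {x} {y} {z} x≐y y≐z = resp (cancelᶜ (inverseʳ y) (x ⁻¹) z) (∙-closed x≐y y≐z)

    ≐-translate : ∀ g {x y} → x ≐ y → g ∙ x ≐ g ∙ y
    ≐-translate g {x} {y} = resp (sym (translate-\\ g x y))

    ≐-cancelˡ : ∀ g {x y} → g ∙ x ≐ g ∙ y → x ≐ y
    ≐-cancelˡ g {x} {y} = resp (translate-\\ g x y)

    ≐ε⇒∈H : ∀ {u} → u ≐ ε → H u
    ≐ε⇒∈H {u} = resp (⁻¹-involutive u) ∘ ⁻¹-closed ∘ resp (identityʳ (u ⁻¹))

    module _ {r} {R : Carrier → Carrier → Set r} (equiv : IsCosetEquivalence G H R) where
      open IsCosetEquivalence equiv
        renaming (reflexive to ∼-refl; symmetric to ∼-sym; transitive to ∼-trans)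

      infix 4 _∼[_]_
      _∼[_]_ : Carrier → Carrier → Carrier → Set r
      x ∼[ g ] y = R (g ⁻¹ ∙ x) (g ⁻¹ ∙ y)

      ∼[]-refl : ∀ {g x} → ¬ g ≐ x → x ∼[ g ] x
      ∼[]-refl g≉x = ∼-refl (g≉x ∘ ≐ε⇒∈H)

      ∼[]-resp : ∀ {g x x′ y y′} → x ≐ x′ → y ≐ y′ → x ∼[ g ] y → x′ ∼[ g ] y′
      ∼[]-resp {g} x≐x′ y≐y′ = wellDef (≐-translate (g ⁻¹) x≐x′) (≐-translate (g ⁻¹) y≐y′)

      ∼[ε]⇒∼ : ∀ {x y} → x ∼[ ε ] y → R x y
      ∼[ε]⇒∼ {x} {y} = wellDef (≈⇒≐ (ε\\x≈x x)) (≈⇒≐ (ε\\x≈x y))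

      module _ (inverse-law : ∀ a b → R a b → ¬ a ≐ b → R (a ⁻¹) (a ⁻¹ ∙ b)) where

        ∼[]-rotate : ∀ {g x y} → x ∼[ g ] y → ¬ x ≐ y → g ∼[ x ] y
        ∼[]-rotate {g} {x} {y} x∼y x≉y =
          wellDef (≈⇒≐ (⁻¹-anti-homo-\\ g x))
                  (≈⇒≐ (translate-\\ (g ⁻¹) x y))
                  (inverse-law _ _ x∼y (x≉y ∘ ≐-cancelˡ (g ⁻¹)))

        module _ (_≐?_ : Decidable _≐_) {a b} (a≉b : ¬ a ≐ b) (a≉ε : ¬ a ≐ ε)
                 (related-off : ∀ g → ¬ g ≐ a → ¬ g ≐ b → a ∼[ g ] b) where

          ∼[a]b : ∀ {z} → ¬ z ≐ a → z ∼[ a ] b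
          ∼[a]b {z} z≉a with z ≐? b
          ... | yes z≐b = ∼[]-resp (≐-sym z≐b) ≐-refl (∼[]-refl a≉b)
          ... | no z≉b  = ∼[]-rotate (related-off z z≉a z≉b) a≉b

          a∼ : ∀ {x} → ¬ x ≐ ε → R a x
          a∼ {x} x≉ε with x ≐? a
          ... | yes x≐a = wellDef ≐-refl (≐-sym x≐a) (∼-refl a≉ε)
          ... | no x≉a  = ∼[ε]⇒∼ (∼[]-rotate (∼-trans (∼[a]b ε≉a) (∼-sym (∼[a]b x≉a)))
                                             (x≉ε ∘ ≐-sym))
            where
            ε≉a : ¬ ε ≐ a
            ε≉a = a≉ε ∘ ≐-sym

          ∼-total : ∀ {x y} → ¬ x ≐ ε → ¬ y ≐ ε → R x y
          ∼-total x≉ε y≉ε = ∼-trans (∼-sym (a∼ x≉ε)) (a∼ y≉ε)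

        related-off⇒≐ : Decidable _≐_ → Nontrivial G H R → ∀ a b →
                           (∀ g → ¬ g ≐ a → ¬ g ≐ b → a ∼[ g ] b) → a ≐ b
        related-off⇒≐ _≐?_ (x , y , x≉ε , y≉ε , x≁y) a b related-off with a ≐? b | a ≐? ε
        ... | yes a≐b | _ = a≐b
        ... | no a≉b | no a≉ε = ⊥-elim (x≁y (∼-total _≐?_ a≉b a≉ε related-off x≉ε y≉ε))
        ... | no a≉b | yes a≐ε = ⊥-elim (x≁y (∼-total _≐?_ (a≉b ∘ ≐-sym) b≉ε related-off′ x≉ε y≉ε))
          where
          b≉ε : ¬ b ≐ ε
          b≉ε b≐ε = a≉b (≐-trans a≐ε (≐-sym b≐ε))
          related-off′ : ∀ g → ¬ g ≐ b → ¬ g ≐ a → b ∼[ g ] a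
          related-off′ g g≉b g≉a = ∼-sym (related-off g g≉a g≉b)

lemma3p8 : {ℓ : Level} → ExcludedMiddle ℓ → (G : Group ℓ ℓ) →
    let open Group G in
    (H : Carrier → Set ℓ) → IsSubgroup G H →
    (R : Carrier → Carrier → Set ℓ) → IsCosetEquivalence G H R → Nontrivial G H R →
    (∀ a b → R a b → ¬ CosetEq G H a b → R (a ⁻¹) (a ⁻¹ ∙ b)) →
    ∀ a b →
    (∀ g → ¬ CosetEq G H g a → ¬ CosetEq G H g b → R (g ⁻¹ ∙ a) (g ⁻¹ ∙ b)) →
    CosetEq G H a b
lemma3p8 em G H sub R equiv nontrivial inverse-law =
  related-off⇒≐ G sub equiv inverse-law (λ _ _ → em) nontrivial
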